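{- Let $\{G_k^*(x)\}$ be a generalized Fibonacci polynomial sequence of Lucas type and set $d_k=\gcd(G_0^*(x),G_k^*(x))$. Suppose there is an integer $k'>0$ with $d_{k'}=2$, and let $m$ be the minimum positive integer such that $d_m=2$. Then for every positive integer $n$, $m\mid n$ if and only if $d_n=2$.
   Context: All polynomials lie in $\mathbb{Z}[x]$ and $\gcd$ denotes the greatest common divisor in $\mathbb{Z}[x]$ (determined up to sign). A generalized Fibonacci polynomial (GFP) sequence $\{G_n(x)\}_{n\ge0}$ is given by $G_0(x)=p_0(x)$, $G_1(x)=p_1(x)$ and $G_n(x)=d(x)G_{n-1}(x)+g(x)G_{n-2}(x)$ for $n\ge 2$, where $p_0(x)$ is a constant and $p_1(x),d(x),g(x)$ are nonzero polynomials in $\mathbb{Z}[x]$ with $\gcd(d(x),g(x))=1$; as in the paper it is assumed that $d(x)^2+4g(x)>0$. Let $a,b$ be the roots of $z^2-d(x)z-g(x)=0$. The sequence is of Lucas type if $p_0\ne 0$, $2p_1(x)=p_0\,d(x)$, $|p_0|\in\{1,2\}$, and $\gcd(p_0,p_1(x))=\gcd(p_0,d(x))=\gcd(p_0,g(x))=1$; then, with $\alpha=2/p_0$, $G_n=(a^n+b^n)/\alpha$ (denoted $G_n^*$). -}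

module Defs where

open import Data.Nat as ℕ using (ℕ; zero; suc)
open import Data.Integer as ℤ using (ℤ; +_)
open import Data.List using (List; []; _∷_; map)
open import Data.Product using (Σ; _×_)
import Data.Sum
open import Relation.Binary.PropositionalEquality using (_≡_)
open import Relation.Nullary using (¬_)

-- Polynomials in ℤ[x], represented by coefficient lists (constant term first).
-- The representation is not canonical (trailing zeros allowed); equality of
-- polynomials is the relation _≈P_ (equal coefficients everywhere).
Poly : Set
Poly = List ℤ

coeff : Poly → ℕ → ℤ
coeff []       _       = + 0
coeff (a ∷ p)  zero    = a
coeff (a ∷ p)  (suc i) = coeff p i

infix 4 _≈P_
_≈P_ : Poly → Poly → Set
p ≈P q = ∀ i → coeff p i ≡ coeff q i

C : ℤ → Poly
C a = a ∷ []

0P : Poly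
0P = []

infixl 6 _+P_
_+P_ : Poly → Poly → Poly
[]      +P q       = q
(a ∷ p) +P []      = a ∷ p
(a ∷ p) +P (b ∷ q) = (a ℤ.+ b) ∷ (p +P q)

infixl 7 _*P_
_*P_ : Poly → Poly → Poly
[]      *P q = []
(a ∷ p) *P q = map (a ℤ.*_) q +P (+ 0 ∷ (p *P q))

eval : Poly → ℤ → ℤ
eval []      x = + 0
eval (a ∷ p) x = a ℤ.+ x ℤ.* eval p x

infix 4 _∣P_
_∣P_ : Poly → Poly → Set
p ∣P q = Σ Poly (λ r → r *P p ≈P q)

-- "g is a greatest common divisor of p and q in ℤ[x]" (gcd is determined up
-- to sign, so "gcd(p,q) = c" means "c is a gcd of p and q").
IsGCD : Poly → Poly → Poly → Set
IsGCD g p q = (g ∣P p) × (g ∣P q) × (∀ c → c ∣P p → c ∣P q → c ∣P g)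

GFP : ℤ → Poly → Poly → Poly → ℕ → Poly
GFP p0 p1 d g zero          = C p0
GFP p0 p1 d g (suc zero)    = p1
GFP p0 p1 d g (suc (suc n)) = d *P GFP p0 p1 d g (suc n) +P g *P GFP p0 p1 d g n

record LucasType (p0 : ℤ) (p1 d g : Poly) : Set where
  field
    p1≠0      : ¬ (p1 ≈P 0P)
    d≠0       : ¬ (d ≈P 0P)
    g≠0       : ¬ (g ≈P 0P)
    gcd-d-g   : IsGCD (C (+ 1)) d g
    -- d(x)^2 + 4 g(x) > 0, read as: positive at every integer x
    disc-pos  : ∀ (x : ℤ) → + 0 ℤ.< eval (d *P d +P C (+ 4) *P g) x
    p0≠0      : ¬ (p0 ≡ + 0)
    two-p1    : C (+ 2) *P p1 ≈P C p0 *P d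
    abs-p0    : (ℤ.∣ p0 ∣ ≡ 1) Data.Sum.⊎ (ℤ.∣ p0 ∣ ≡ 2)
    gcd-p0-p1 : IsGCD (C (+ 1)) (C p0) p1
    gcd-p0-d  : IsGCD (C (+ 1)) (C p0) d
    gcd-p0-g  : IsGCD (C (+ 1)) (C p0) g

{-# OPTIONS --safe #-}
-- Since 2 ∣ p₀ and |p₀| ≤ 2, gcd(G₀, Gₙ) = 2 exactly when Gₙ has even coefficients, i.e. when Gₙ
-- vanishes in 𝔽₂[x], an integral domain. There p₁ and g are nonzero (both are coprime to p₀), so
-- no two consecutive terms vanish; in particular G_{m+1} ≠ 0. The cross term G₁G_{n+m} − G_{m+1}Gₙ
-- obeys the same recurrence and vanishes mod 2 for n = 0, 1, hence for all n; cancelling the odd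
-- factors gives G_{n+m} ≡ 0 ⇔ Gₙ ≡ 0 (mod 2), and a predicate with period m that holds at 0 but
-- fails on 1, …, m − 1 holds exactly on the multiples of m.
module Submission where

open import Defs
open import Data.Nat using (ℕ; _<_; zero; suc; NonZero; >-nonZero; z<s)
open import Data.Nat.Divisibility using (_∣_)
open import Data.Integer using (ℤ; +_; -[1+_])
open import Data.Product using (Σ; _×_; _,_; proj₁; proj₂)
open import Function.Bundles using (_⇔_; mk⇔; Equivalence)
open import Relation.Nullary using (¬_; Dec; yes; no)

open import Algebra.Bundles using (CommutativeRing)
open import Data.Empty using (⊥-elim)
import Data.Integer as ℤ
import Data.Integer.Divisibility.Signed as ℤ∣
import Data.Integer.Properties as ℤP
open import Data.Integer.Tactic.RingSolver using (solve-∀)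
open import Data.List using ([]; _∷_; map)
open import Data.Maybe as Maybe using (Maybe; just; nothing)
import Data.Nat as ℕ
import Data.Nat.Divisibility as ℕ∣
open import Data.Nat.DivMod using (_%_; _/_; m≡m%n+[m/n]*n; m%n<n)
open import Data.Nat.Primality using (prime?; euclidsLemma)
import Data.Nat.Properties as ℕP
open import Data.Sum using (_⊎_; inj₁; inj₂)
open import Function using (_∘_)
open import Function.Construct.Composition using (_⇔-∘_)
open import Function.Construct.Identity using (⇔-id)
open import Function.Construct.Symmetry using (⇔-sym)
open import Level using (0ℓ)
open import Relation.Binary.PropositionalEquality
open import Relation.Nullary.Decidable using (from-yes; map′)
import Tactic.RingSolver.Core.AlmostCommutativeRing as Solver
open import Tactic.RingSolver using () renaming (solve-∀ to solve-∀-Poly)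

infix 4 2∣_
2∣_ : ℤ → Set
2∣ a = + 2 ℤ∣.∣ a

2∣? : ∀ a → Dec (2∣ a)
2∣? a = map′ ℤ∣.∣ᵤ⇒∣ ℤ∣.∣⇒∣ᵤ (2 ℕ∣.∣? ℤ.∣ a ∣)

¬2∣1 : ¬ 2∣ + 1
¬2∣1 2∣1 with ℕ∣.∣1⇒≡1 (ℤ∣.∣⇒∣ᵤ 2∣1)
... | ()

¬2∣-* : ∀ {a b} → ¬ 2∣ a → ¬ 2∣ b → ¬ 2∣ a ℤ.* b
¬2∣-* {a} {b} ¬2∣a ¬2∣b 2∣ab
  with euclidsLemma ℤ.∣ a ∣ ℤ.∣ b ∣ (from-yes (prime? 2))
                    (subst (2 ℕ∣.∣_) (ℤP.abs-* a b) (ℤ∣.∣⇒∣ᵤ 2∣ab))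
... | inj₁ 2∣a = ¬2∣a (ℤ∣.∣ᵤ⇒∣ 2∣a)
... | inj₂ 2∣b = ¬2∣b (ℤ∣.∣ᵤ⇒∣ 2∣b)

2∣0 : 2∣ + 0
2∣0 = ℤ∣.divides (+ 0) refl

-- The map in the definition of _*P_, so (a ∷ p) *P q unfolds to scale a q +P (+ 0 ∷ p *P q).
scale : ℤ → Poly → Poly
scale a = map (a ℤ.*_)

negP : Poly → Poly
negP = map (λ a → ℤ.- a)

coeff-+P : ∀ p q i → coeff (p +P q) i ≡ coeff p i ℤ.+ coeff q i
coeff-+P []      q       i       = sym (ℤP.+-identityˡ _)
coeff-+P (a ∷ p) []      i       = sym (ℤP.+-identityʳ _)
coeff-+P (a ∷ p) (b ∷ q) zero    = refl
coeff-+P (a ∷ p) (b ∷ q) (suc i) = coeff-+P p q i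

coeff-map : ∀ f → f (+ 0) ≡ + 0 → ∀ p i → coeff (map f p) i ≡ f (coeff p i)
coeff-map f f0≡0 []      i       = sym f0≡0
coeff-map f f0≡0 (a ∷ p) zero    = refl
coeff-map f f0≡0 (a ∷ p) (suc i) = coeff-map f f0≡0 p i

coeff-scale : ∀ a p i → coeff (scale a p) i ≡ a ℤ.* coeff p i
coeff-scale a = coeff-map (a ℤ.*_) (ℤP.*-zeroʳ a)

coeff-negP : ∀ p i → coeff (negP p) i ≡ ℤ.- coeff p i
coeff-negP = coeff-map (λ a → ℤ.- a) refl

-- _≈P_ wrapped in a record, so that its two indices can be inferred.
infix 4 _≋_
record _≋_ (p q : Poly) : Set where
  constructor mk≋
  field coeff-≡ : p ≈P q
open _≋_

≋-refl : ∀ {p} → p ≋ p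
≋-refl = mk≋ λ _ → refl

≋-sym : ∀ {p q} → p ≋ q → q ≋ p
≋-sym (mk≋ e) = mk≋ (sym ∘ e)

≋-trans : ∀ {p q r} → p ≋ q → q ≋ r → p ≋ r
≋-trans (mk≋ e) (mk≋ f) = mk≋ λ i → trans (e i) (f i)

∷-cong : ∀ {a b p q} → a ≡ b → p ≋ q → a ∷ p ≋ b ∷ q
∷-cong a≡b (mk≋ e) = mk≋ λ { zero → a≡b ; (suc i) → e i }

0∷≋[] : ∀ {p} → p ≋ [] → + 0 ∷ p ≋ []
0∷≋[] (mk≋ e) = mk≋ λ { zero → refl ; (suc i) → e i }

+P-cong : ∀ {p p′ q q′} → p ≋ p′ → q ≋ q′ → p +P q ≋ p′ +P q′
+P-cong {p} {p′} {q} {q′} (mk≋ e) (mk≋ f) = mk≋ λ i → begin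
  coeff (p +P q) i           ≡⟨ coeff-+P p q i ⟩
  coeff p i ℤ.+ coeff q i    ≡⟨ cong₂ ℤ._+_ (e i) (f i) ⟩
  coeff p′ i ℤ.+ coeff q′ i  ≡⟨ coeff-+P p′ q′ i ⟨
  coeff (p′ +P q′) i         ∎
  where open ≡-Reasoning

negP-cong : ∀ {p q} → p ≋ q → negP p ≋ negP q
negP-cong {p} {q} (mk≋ e) =
  mk≋ λ i → trans (coeff-negP p i) (trans (cong (λ a → ℤ.- a) (e i)) (sym (coeff-negP q i)))

scale-cong : ∀ a {p q} → p ≋ q → scale a p ≋ scale a q
scale-cong a {p} {q} (mk≋ e) =
  mk≋ λ i → trans (coeff-scale a p i) (trans (cong (a ℤ.*_) (e i)) (sym (coeff-scale a q i)))

+P-assoc : ∀ p q r → (p +P q) +P r ≋ p +P (q +P r)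
+P-assoc p q r = mk≋ λ i → begin
  coeff ((p +P q) +P r) i                  ≡⟨ coeff-+P (p +P q) r i ⟩
  coeff (p +P q) i ℤ.+ coeff r i           ≡⟨ cong (ℤ._+ coeff r i) (coeff-+P p q i) ⟩
  coeff p i ℤ.+ coeff q i ℤ.+ coeff r i    ≡⟨ ℤP.+-assoc (coeff p i) _ _ ⟩
  coeff p i ℤ.+ (coeff q i ℤ.+ coeff r i)  ≡⟨ cong (λ x → coeff p i ℤ.+ x) (coeff-+P q r i) ⟨
  coeff p i ℤ.+ coeff (q +P r) i           ≡⟨ coeff-+P p (q +P r) i ⟨
  coeff (p +P (q +P r)) i                  ∎
  where open ≡-Reasoning

+P-comm : ∀ p q → p +P q ≋ q +P p
+P-comm p q = mk≋ λ i →
  trans (coeff-+P p q i) (trans (ℤP.+-comm (coeff p i) _) (sym (coeff-+P q p i)))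

+P-identityʳ : ∀ p → p +P [] ≋ p
+P-identityʳ p = mk≋ λ i → trans (coeff-+P p [] i) (ℤP.+-identityʳ _)

+P-inverseˡ : ∀ p → negP p +P p ≋ []
+P-inverseˡ p = mk≋ λ i →
  trans (coeff-+P (negP p) p i) (trans (cong (ℤ._+ coeff p i) (coeff-negP p i)) (ℤP.+-inverseˡ (coeff p i)))

+P-inverseʳ : ∀ p → p +P negP p ≋ []
+P-inverseʳ p = ≋-trans (+P-comm p (negP p)) (+P-inverseˡ p)

+P-interchange : ∀ p q r s → (p +P q) +P (r +P s) ≋ (p +P r) +P (q +P s)
+P-interchange p q r s = mk≋ λ i → begin
  coeff ((p +P q) +P (r +P s)) i
    ≡⟨ trans (coeff-+P (p +P q) _ i) (cong₂ ℤ._+_ (coeff-+P p q i) (coeff-+P r s i)) ⟩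
  (coeff p i ℤ.+ coeff q i) ℤ.+ (coeff r i ℤ.+ coeff s i)
    ≡⟨ interchange (coeff p i) _ _ _ ⟩
  (coeff p i ℤ.+ coeff r i) ℤ.+ (coeff q i ℤ.+ coeff s i)
    ≡⟨ trans (coeff-+P (p +P r) _ i) (cong₂ ℤ._+_ (coeff-+P p r i) (coeff-+P q s i)) ⟨
  coeff ((p +P r) +P (q +P s)) i ∎
  where
  open ≡-Reasoning
  interchange : ∀ a b c d → (a ℤ.+ b) ℤ.+ (c ℤ.+ d) ≡ (a ℤ.+ c) ℤ.+ (b ℤ.+ d)
  interchange = solve-∀

scale-distribˡ-+P : ∀ a p q → scale a (p +P q) ≋ scale a p +P scale a q
scale-distribˡ-+P a p q = mk≋ λ i → begin
  coeff (scale a (p +P q)) i                 ≡⟨ coeff-scale a (p +P q) i ⟩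
  a ℤ.* coeff (p +P q) i                     ≡⟨ cong (a ℤ.*_) (coeff-+P p q i) ⟩
  a ℤ.* (coeff p i ℤ.+ coeff q i)            ≡⟨ ℤP.*-distribˡ-+ a _ _ ⟩
  a ℤ.* coeff p i ℤ.+ a ℤ.* coeff q i        ≡⟨ cong₂ ℤ._+_ (coeff-scale a p i) (coeff-scale a q i) ⟨
  coeff (scale a p) i ℤ.+ coeff (scale a q) i ≡⟨ coeff-+P (scale a p) _ i ⟨
  coeff (scale a p +P scale a q) i           ∎
  where open ≡-Reasoning

scale-scale : ∀ a b p → scale a (scale b p) ≋ scale (a ℤ.* b) p
scale-scale a b p = mk≋ λ i → begin
  coeff (scale a (scale b p)) i ≡⟨ coeff-scale a (scale b p) i ⟩
  a ℤ.* coeff (scale b p) i     ≡⟨ cong (a ℤ.*_) (coeff-scale b p i) ⟩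
  a ℤ.* (b ℤ.* coeff p i)       ≡⟨ ℤP.*-assoc a b _ ⟨
  a ℤ.* b ℤ.* coeff p i         ≡⟨ coeff-scale (a ℤ.* b) p i ⟨
  coeff (scale (a ℤ.* b) p) i   ∎
  where open ≡-Reasoning

scale-zero : ∀ p → scale (+ 0) p ≋ []
scale-zero p = mk≋ (coeff-scale (+ 0) p)

*P-congˡ : ∀ p {q q′} → q ≋ q′ → p *P q ≋ p *P q′
*P-congˡ []      q≋q′ = ≋-refl
*P-congˡ (a ∷ p) q≋q′ = +P-cong (scale-cong a q≋q′) (∷-cong refl (*P-congˡ p q≋q′))

*P-distribˡ-+P : ∀ p q r → p *P (q +P r) ≋ p *P q +P p *P r
*P-distribˡ-+P []      q r = ≋-refl
*P-distribˡ-+P (a ∷ p) q r =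
  ≋-trans (+P-cong (scale-distribˡ-+P a q r) (∷-cong refl (*P-distribˡ-+P p q r)))
          (+P-interchange (scale a q) (scale a r) (+ 0 ∷ p *P q) (+ 0 ∷ p *P r))

*P-zeroʳ : ∀ p → p *P [] ≋ []
*P-zeroʳ []      = ≋-refl
*P-zeroʳ (a ∷ p) = 0∷≋[] (*P-zeroʳ p)

*P-∷ʳ : ∀ p a q → p *P (a ∷ q) ≋ scale a p +P (+ 0 ∷ p *P q)
*P-∷ʳ []      a q = mk≋ λ { zero → refl ; (suc i) → refl }
*P-∷ʳ (b ∷ p) a q =
  ∷-cong (cong (ℤ._+ + 0) (ℤP.*-comm b a))
    (≋-trans (+P-cong (≋-refl {scale b q}) (*P-∷ʳ p a q))
      (≋-trans (≋-sym (+P-assoc (scale b q) (scale a p) _))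
        (≋-trans (+P-cong (+P-comm (scale b q) (scale a p)) ≋-refl)
          (+P-assoc (scale a p) (scale b q) _))))

*P-comm : ∀ p q → p *P q ≋ q *P p
*P-comm []      q = ≋-sym (*P-zeroʳ q)
*P-comm (a ∷ p) q =
  ≋-trans (+P-cong (≋-refl {scale a q}) (∷-cong refl (*P-comm p q))) (≋-sym (*P-∷ʳ q a p))

*P-congʳ : ∀ {p p′} q → p ≋ p′ → p *P q ≋ p′ *P q
*P-congʳ {p} {p′} q p≋p′ = ≋-trans (*P-comm p q) (≋-trans (*P-congˡ q p≋p′) (*P-comm q p′))

*P-distribʳ-+P : ∀ p q r → (p +P q) *P r ≋ p *P r +P q *P r
*P-distribʳ-+P p q r =
  ≋-trans (*P-comm (p +P q) r)
    (≋-trans (*P-distribˡ-+P r p q) (+P-cong (*P-comm r p) (*P-comm r q)))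

*P-identityˡ : ∀ p → C (+ 1) *P p ≋ p
*P-identityˡ p = mk≋ λ i → begin
  coeff (scale (+ 1) p +P (+ 0 ∷ [])) i         ≡⟨ coeff-+P (scale (+ 1) p) _ i ⟩
  coeff (scale (+ 1) p) i ℤ.+ coeff (+ 0 ∷ []) i ≡⟨ cong₂ ℤ._+_ (coeff-scale (+ 1) p i) (coeff-0∷[] i) ⟩
  + 1 ℤ.* coeff p i ℤ.+ + 0                     ≡⟨ ℤP.+-identityʳ _ ⟩
  + 1 ℤ.* coeff p i                             ≡⟨ ℤP.*-identityˡ _ ⟩
  coeff p i                                     ∎
  where
  open ≡-Reasoning
  coeff-0∷[] : ∀ i → coeff (+ 0 ∷ []) i ≡ + 0
  coeff-0∷[] zero    = refl
  coeff-0∷[] (suc i) = refl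

*P-identityʳ : ∀ p → p *P C (+ 1) ≋ p
*P-identityʳ p = ≋-trans (*P-comm p (C (+ 1))) (*P-identityˡ p)

scale-*P : ∀ a p q → scale a p *P q ≋ scale a (p *P q)
scale-*P a []      q = ≋-refl
scale-*P a (b ∷ p) q =
  ≋-trans (+P-cong (≋-sym (scale-scale a b q)) (∷-cong (sym (ℤP.*-zeroʳ a)) (scale-*P a p q)))
          (≋-sym (scale-distribˡ-+P a (scale b q) (+ 0 ∷ p *P q)))

*P-assoc : ∀ p q r → (p *P q) *P r ≋ p *P (q *P r)
*P-assoc []      q r = ≋-refl
*P-assoc (a ∷ p) q r =
  ≋-trans (*P-distribʳ-+P (scale a q) (+ 0 ∷ p *P q) r)
    (+P-cong (scale-*P a q r)
      (+P-cong (scale-zero r) (∷-cong refl (*P-assoc p q r))))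

polyRing : CommutativeRing 0ℓ 0ℓ
polyRing = record
  { Carrier = Poly ; _≈_ = _≋_ ; _+_ = _+P_ ; _*_ = _*P_ ; -_ = negP ; 0# = [] ; 1# = C (+ 1)
  ; isCommutativeRing = record
    { isRing = record
      { +-isAbelianGroup = record
        { isGroup = record
          { isMonoid = record
            { isSemigroup = record
              { isMagma = record
                { isEquivalence = record { refl = ≋-refl ; sym = ≋-sym ; trans = ≋-trans }
                ; ∙-cong = +P-cong }
              ; assoc = +P-assoc }
            ; identity = (λ _ → ≋-refl) , +P-identityʳ }
          ; inverse = +P-inverseˡ , +P-inverseʳ
          ; ⁻¹-cong = negP-cong }
        ; comm = +P-comm }
      ; *-cong = λ {p} {p′} {q} e f → ≋-trans (*P-congʳ q e) (*P-congˡ p′ f)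
      ; *-assoc = *P-assoc
      ; *-identity = *P-identityˡ , *P-identityʳ
      ; distrib = *P-distribˡ-+P , λ r p q → *P-distribʳ-+P p q r }
    ; *-comm = *P-comm } }

-- The zero test lets the solver cancel monomials whose coefficients sum to zero.
polyRing-solver : Solver.AlmostCommutativeRing 0ℓ 0ℓ
polyRing-solver = Solver.fromCommutativeRing polyRing []≋?
  where
  []≋? : ∀ p → Maybe ([] ≋ p)
  []≋? []             = just ≋-refl
  []≋? (+ 0 ∷ p)       = Maybe.map (≋-sym ∘ 0∷≋[] ∘ ≋-sym) ([]≋? p)
  []≋? (+ suc _ ∷ _)   = nothing
  []≋? (-[1+ _ ] ∷ _)  = nothing

record Even (p : Poly) : Set where
  constructor mkEven
  field coeff-even : ∀ i → 2∣ coeff p i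
open Even

Even-resp-≋ : ∀ {p q} → p ≋ q → Even p → Even q
Even-resp-≋ (mk≋ e) (mkEven ev) = mkEven λ i → subst 2∣_ (e i) (ev i)

Even-[] : Even []
Even-[] = mkEven λ _ → 2∣0

Even-∷ : ∀ {a p} → 2∣ a → Even p → Even (a ∷ p)
Even-∷ 2∣a (mkEven ev) = mkEven λ { zero → 2∣a ; (suc i) → ev i }

Even-head : ∀ {a p} → Even (a ∷ p) → 2∣ a
Even-head (mkEven ev) = ev 0

Even-tail : ∀ {a p} → Even (a ∷ p) → Even p
Even-tail (mkEven ev) = mkEven (ev ∘ suc)

Even? : ∀ p → Dec (Even p)
Even? []      = yes Even-[]
Even? (a ∷ p) with 2∣? a | Even? p
... | yes 2∣a | yes ev = yes (Even-∷ 2∣a ev)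
... | no ¬2∣a | _      = no (¬2∣a ∘ Even-head)
... | yes _   | no ¬ev = no (¬ev ∘ Even-tail)

Even-+P : ∀ {p q} → Even p → Even q → Even (p +P q)
Even-+P {p} {q} (mkEven ev) (mkEven ev′) =
  mkEven λ i → subst 2∣_ (sym (coeff-+P p q i)) (ℤ∣.∣m∣n⇒∣m+n (ev i) (ev′ i))

Even-negP : ∀ {p} → Even p → Even (negP p)
Even-negP {p} (mkEven ev) = mkEven λ i → subst 2∣_ (sym (coeff-negP p i)) (ℤ∣.∣m⇒∣-m (ev i))

Even-scaleʳ : ∀ a {p} → Even p → Even (scale a p)
Even-scaleʳ a {p} (mkEven ev) = mkEven λ i → subst 2∣_ (sym (coeff-scale a p i)) (ℤ∣.∣n⇒∣m*n a (ev i))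

Even-scaleˡ : ∀ {a} p → 2∣ a → Even (scale a p)
Even-scaleˡ {a} p 2∣a = mkEven λ i →
  subst 2∣_ (sym (trans (coeff-scale a p i) (ℤP.*-comm a _))) (ℤ∣.∣n⇒∣m*n (coeff p i) 2∣a)

Even-*Pʳ : ∀ p {q} → Even q → Even (p *P q)
Even-*Pʳ []      ev = Even-[]
Even-*Pʳ (a ∷ p) ev = Even-+P (Even-scaleʳ a ev) (Even-∷ 2∣0 (Even-*Pʳ p ev))

Even-+P-cancelˡ : ∀ {p q} → Even p → Even (p +P q) → Even q
Even-+P-cancelˡ {p} {q} ev-p ev-pq = Even-resp-≋ (≋-sym (q≋p+q-p p q)) (Even-+P ev-pq (Even-negP ev-p))
  where
  q≋p+q-p : ∀ p q → q ≋ (p +P q) +P negP p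
  q≋p+q-p = solve-∀-Poly polyRing-solver

Even-∷-*P : ∀ {a} p q → 2∣ a → Even ((a ∷ p) *P q) → Even (p *P q)
Even-∷-*P p q 2∣a ev = Even-tail (Even-+P-cancelˡ (Even-scaleˡ q 2∣a) ev)

Even-*P-∷ : ∀ {b} p q → 2∣ b → Even (p *P (b ∷ q)) → Even (p *P q)
Even-*P-∷ {b} p q 2∣b ev =
  Even-resp-≋ (*P-comm q p) (Even-∷-*P q p 2∣b (Even-resp-≋ (*P-comm p (b ∷ q)) ev))

¬Even-∷-*P : ∀ {a} p q → ¬ 2∣ a → ¬ Even q → ¬ Even ((a ∷ p) *P q)
¬Even-∷-*P p []      _    ¬ev-q _  = ¬ev-q Even-[]
¬Even-∷-*P {a} p (b ∷ q) ¬2∣a ¬ev-q ev with 2∣? b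
... | yes 2∣b = ¬Even-∷-*P p q ¬2∣a (¬ev-q ∘ Even-∷ 2∣b) (Even-*P-∷ (a ∷ p) q 2∣b ev)
... | no ¬2∣b = ¬2∣-* ¬2∣a ¬2∣b (subst 2∣_ (ℤP.+-identityʳ (a ℤ.* b)) (Even-head ev))

-- 𝔽₂[x] is an integral domain: discard even constant terms until both constant terms are odd.
¬Even-*P : ∀ p q → ¬ Even p → ¬ Even q → ¬ Even (p *P q)
¬Even-*P []      q ¬ev-p _     _  = ¬ev-p Even-[]
¬Even-*P (a ∷ p) q ¬ev-p ¬ev-q ev with 2∣? a
... | yes 2∣a = ¬Even-*P p q (¬ev-p ∘ Even-∷ 2∣a) ¬ev-q (Even-∷-*P p q 2∣a ev)
... | no ¬2∣a = ¬Even-∷-*P p q ¬2∣a ¬ev-q ev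

Even-*P-cancelˡ : ∀ p {q} → ¬ Even p → Even (p *P q) → Even q
Even-*P-cancelˡ p {q} ¬ev-p ev-pq with Even? q
... | yes ev-q = ev-q
... | no ¬ev-q = ⊥-elim (¬Even-*P p q ¬ev-p ¬ev-q ev-pq)

C2∣P⇒Even : ∀ {p} → C (+ 2) ∣P p → Even p
C2∣P⇒Even (r , r*2≈p) = Even-resp-≋ (mk≋ r*2≈p) (Even-*Pʳ r (Even-∷ (ℤ∣.divides (+ 1) refl) Even-[]))

Even⇒C2∣P : ∀ {p} → Even p → C (+ 2) ∣P p
Even⇒C2∣P {[]}    _  = [] , λ _ → refl
Even⇒C2∣P {a ∷ p} ev with Even-head ev | Even⇒C2∣P (Even-tail ev)
... | ℤ∣.divides k a≡k*2 | r , r*2≈p =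
  k ∷ r , λ { zero → trans (ℤP.+-identityʳ _) (sym a≡k*2) ; (suc i) → r*2≈p i }

∣P-trans : ∀ {p q r} → p ∣P q → q ∣P r → p ∣P r
∣P-trans {p} {q} {r} (s , s*p≈q) (t , t*q≈r) =
  t *P s , coeff-≡ (≋-trans (*P-assoc t s p)
                     (≋-trans (*P-congˡ t (mk≋ {q = q} s*p≈q)) (mk≋ {q = r} t*q≈r)))

C∣P-C2 : ∀ {a} → (ℤ.∣ a ∣ ≡ 1) ⊎ (ℤ.∣ a ∣ ≡ 2) → C a ∣P C (+ 2)
C∣P-C2 {+ .1}      (inj₁ refl) = C (+ 2)      , λ { zero → refl ; (suc _) → refl }
C∣P-C2 { -[1+ .0 ]} (inj₁ refl) = C -[1+ 1 ]  , λ { zero → refl ; (suc _) → refl }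
C∣P-C2 {+ .2}      (inj₂ refl) = C (+ 1)      , λ { zero → refl ; (suc _) → refl }
C∣P-C2 { -[1+ .1 ]} (inj₂ refl) = C -[1+ 0 ]  , λ { zero → refl ; (suc _) → refl }

IsGCD-C2⇔Even : ∀ {p} → p ∣P C (+ 2) → Even p → ∀ q → IsGCD (C (+ 2)) p q ⇔ Even q
IsGCD-C2⇔Even p∣2 ev-p q = mk⇔
  (C2∣P⇒Even ∘ proj₁ ∘ proj₂)
  (λ ev-q → Even⇒C2∣P ev-p , Even⇒C2∣P ev-q , λ c c∣p _ → ∣P-trans {c} {_} {C (+ 2)} c∣p p∣2)

¬Even-coprime : ∀ {p q} → IsGCD (C (+ 1)) p q → Even p → ¬ Even q
¬Even-coprime (_ , _ , greatest) ev-p ev-q =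
  ¬2∣1 (Even-head (C2∣P⇒Even (greatest (C (+ 2)) (Even⇒C2∣P ev-p) (Even⇒C2∣P ev-q))))

Even-recurrence : ∀ d g (u : ℕ → Poly) → (∀ n → u (suc (suc n)) ≋ d *P u (suc n) +P g *P u n) →
                  Even (u 0) → Even (u 1) → ∀ n → Even (u n)
Even-recurrence d g u recurrence ev₀ ev₁ = proj₁ ∘ consecutive
  where
  consecutive : ∀ n → Even (u n) × Even (u (suc n))
  consecutive zero    = ev₀ , ev₁
  consecutive (suc n) = let evₙ , evₙ₊₁ = consecutive n in
    evₙ₊₁ , Even-resp-≋ (≋-sym (recurrence n)) (Even-+P (Even-*Pʳ d evₙ₊₁) (Even-*Pʳ g evₙ))

module GFP-parity (p0 : ℤ) (p1 d g : Poly) where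

  G : ℕ → Poly
  G = GFP p0 p1 d g

  Even-consecutive⇒Even-G1 : ¬ Even g → ∀ k → Even (G k) → Even (G (suc k)) → Even (G 1)
  Even-consecutive⇒Even-G1 ¬ev-g zero    _    ev₁ = ev₁
  Even-consecutive⇒Even-G1 ¬ev-g (suc k) evₖ₊₁ evₖ₊₂ =
    Even-consecutive⇒Even-G1 ¬ev-g k
      (Even-*P-cancelˡ g ¬ev-g (Even-+P-cancelˡ (Even-*Pʳ d evₖ₊₁) evₖ₊₂)) evₖ₊₁

  cross : ℕ → ℕ → Poly
  cross m n = G 1 *P G (n ℕ.+ m) +P negP (G (suc m) *P G n)

  cross-recurrence : ∀ m n → cross m (suc (suc n)) ≋ d *P cross m (suc n) +P g *P cross m n
  cross-recurrence m n = cross-step (G 1) (G (suc m)) d g (G (suc n ℕ.+ m)) (G (n ℕ.+ m)) (G (suc n)) (G n)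
    where
    cross-step : ∀ a b d g x y z w →
            a *P (d *P x +P g *P y) +P negP (b *P (d *P z +P g *P w)) ≋
            d *P (a *P x +P negP (b *P z)) +P g *P (a *P y +P negP (b *P w))
    cross-step = solve-∀-Poly polyRing-solver

  Even-cross : ∀ {m} → Even (G 0) → Even (G m) → ∀ n → Even (cross m n)
  Even-cross {m} ev₀ evₘ = Even-recurrence d g (cross m) (cross-recurrence m)
    (Even-+P (Even-*Pʳ (G 1) evₘ) (Even-negP (Even-*Pʳ (G (suc m)) ev₀)))
    (Even-resp-≋ (≋-sym (ab-ba≋0 (G 1) (G (suc m)))) Even-[])
    where
    ab-ba≋0 : ∀ a b → a *P b +P negP (b *P a) ≋ []
    ab-ba≋0 = solve-∀-Poly polyRing-solver

  Even-G-periodic : ¬ Even g → ¬ Even p1 → Even (G 0) →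
                    ∀ m → Even (G m) → ∀ n → Even (G (n ℕ.+ m)) ⇔ Even (G n)
  Even-G-periodic ¬ev-g ¬ev-p1 ev₀ m evₘ n = mk⇔
    (λ evₙ₊ₘ → Even-*P-cancelˡ (G (suc m)) ¬ev-Gₘ₊₁
      (Even-resp-≋ (≋-sym (by≋ax-cross (G 1) (G (suc m)) _ _))
        (Even-+P (Even-*Pʳ (G 1) evₙ₊ₘ) (Even-negP ev-cross))))
    (λ evₙ → Even-*P-cancelˡ (G 1) ¬ev-p1
      (Even-resp-≋ (≋-sym (ax≋by+cross (G 1) (G (suc m)) _ _))
        (Even-+P (Even-*Pʳ (G (suc m)) evₙ) ev-cross)))
    where
    ¬ev-Gₘ₊₁ : ¬ Even (G (suc m))
    ¬ev-Gₘ₊₁ = ¬ev-p1 ∘ Even-consecutive⇒Even-G1 ¬ev-g m evₘ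
    ev-cross : Even (cross m n)
    ev-cross = Even-cross ev₀ evₘ n
    by≋ax-cross : ∀ a b x y → b *P y ≋ a *P x +P negP (a *P x +P negP (b *P y))
    by≋ax-cross = solve-∀-Poly polyRing-solver
    ax≋by+cross : ∀ a b x y → a *P x ≋ b *P y +P (a *P x +P negP (b *P y))
    ax≋by+cross = solve-∀-Poly polyRing-solver

module _ (P : ℕ → Set) (m : ℕ) .{{_ : NonZero m}} (periodic : ∀ n → P (n ℕ.+ m) ⇔ P n) where

  periodic-+* : ∀ r q → P (r ℕ.+ q ℕ.* m) ⇔ P r
  periodic-+* r zero    = subst (λ k → P k ⇔ P r) (sym (ℕP.+-identityʳ r)) (⇔-id (P r))
  periodic-+* r (suc q) =
    periodic-+* r q ⇔-∘ subst (λ k → P k ⇔ P (r ℕ.+ q ℕ.* m)) r+qm+m≡r+[1+q]m (periodic (r ℕ.+ q ℕ.* m))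
    where
    r+qm+m≡r+[1+q]m : r ℕ.+ q ℕ.* m ℕ.+ m ≡ r ℕ.+ suc q ℕ.* m
    r+qm+m≡r+[1+q]m = trans (ℕP.+-assoc r _ m) (cong (r ℕ.+_) (ℕP.+-comm _ m))

  ∣⇔periodic : P 0 → (∀ j → 0 < j → j < m → ¬ P j) → ∀ n → m ∣ n ⇔ P n
  ∣⇔periodic P0 ¬Pⱼ n =
    ⇔-sym P[n]⇔P[n%m] ⇔-∘ (r≡0⇔P[r] (n % m) (m%n<n n m) ⇔-∘ ⇔-sym (ℕ∣.m%n≡0⇔n∣m n m))
    where
    P[n]⇔P[n%m] : P n ⇔ P (n % m)
    P[n]⇔P[n%m] =
      subst (λ k → P k ⇔ P (n % m)) (sym (m≡m%n+[m/n]*n n m)) (periodic-+* (n % m) (n / m))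
    r≡0⇔P[r] : ∀ r → r < m → r ≡ 0 ⇔ P r
    r≡0⇔P[r] zero    _   = mk⇔ (λ _ → P0) (λ _ → refl)
    r≡0⇔P[r] (suc r) r<m = mk⇔ (λ ()) (⊥-elim ∘ ¬Pⱼ (suc r) z<s r<m)

proposition13 : (p0 : ℤ) (p1 d g : Poly) → LucasType p0 p1 d g →
    Σ ℕ (λ k′ → (0 < k′) × IsGCD (C (+ 2)) (GFP p0 p1 d g 0) (GFP p0 p1 d g k′)) →
    (m : ℕ) → 0 < m → IsGCD (C (+ 2)) (GFP p0 p1 d g 0) (GFP p0 p1 d g m) →
    (∀ j → 0 < j → j < m → ¬ IsGCD (C (+ 2)) (GFP p0 p1 d g 0) (GFP p0 p1 d g j)) →
    (n : ℕ) → 0 < n →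
    ((m ∣ n) ⇔ IsGCD (C (+ 2)) (GFP p0 p1 d g 0) (GFP p0 p1 d g n))
proposition13 p0 p1 d g L _ m 0<m dₘ≡2 minimal n _ =
  ⇔-sym (gcd⇔Even (G n)) ⇔-∘
    ∣⇔periodic (Even ∘ G) m {{>-nonZero 0<m}}
      (Even-G-periodic (¬Even-coprime gcd-p0-g ev₀) (¬Even-coprime gcd-p0-p1 ev₀) ev₀ m evₘ)
      ev₀ (λ j 0<j j<m → minimal j 0<j j<m ∘ Equivalence.from (gcd⇔Even (G j))) n
  where
  open LucasType L
  open GFP-parity p0 p1 d g
  ev₀ : Even (C p0)
  ev₀ = C2∣P⇒Even (proj₁ dₘ≡2)
  gcd⇔Even : ∀ q → IsGCD (C (+ 2)) (C p0) q ⇔ Even q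
  gcd⇔Even = IsGCD-C2⇔Even (C∣P-C2 abs-p0) ev₀
  evₘ : Even (G m)
  evₘ = Equivalence.to (gcd⇔Even (G m)) dₘ≡2
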